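{- Let $G$ and $H$ be two connected nontrivial graphs and $S\subseteq V(G\Box H)$. If $V(G^h)\cup V({}^gH)\subseteq\langle S\rangle_C$ for some $g\in V(G)$ and $h\in V(H)$, then $S$ is a hull set of $G\Box H$.
   Context: All graphs are finite, simple and undirected. Cycle convexity on a graph $G$: for $S\subseteq V(G)$, the cycle interval $\langle S\rangle$ is $S$ together with every vertex $w\in V(G)$ that lies on a cycle of the induced subgraph $G[S\cup\{w\}]$ passing through $w$. $S$ is (cycle) convex if $\langle S\rangle=S$. The cycle convex hull $\langle S\rangle_C$ is the smallest convex set containing $S$ (here computed in $G\Box H$); $S$ is a hull set if $\langle S\rangle_C$ is the whole vertex set. The Cartesian product $G\Box H$ has vertex set $V(G)\times V(H)$, with $(g_1,h_1)\sim(g_2,h_2)$ iff ($g_1\sim g_2$ and $h_1=h_2$) or ($g_1=g_2$ and $h_1\sim h_2$). For $h\in V(H)$, $G^h$ is the subgraph of $G\Box H$ induced by $V(G)\times\{h\}$; for $g\in V(G)$, ${}^gH$ is the subgraph induced by $\{g\}\times V(H)$. A graph is nontrivial if it has at least two vertices. -}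

module Defs where

open import Level using (0ℓ)
open import Data.Nat using (ℕ; _≥_)
open import Data.Fin using (Fin)
open import Data.Product using (Σ; ∃; ∃-syntax; _×_; _,_)
open import Data.Sum using (_⊎_)
open import Data.List using (List; _∷_; _∷ʳ_; length)
open import Data.List.Relation.Unary.All using (All)
open import Data.List.Relation.Unary.Linked using (Linked)
open import Data.List.Relation.Unary.Unique.Propositional using (Unique)
open import Relation.Binary.PropositionalEquality using (_≡_; _≢_)
open import Relation.Binary.Construct.Closure.ReflexiveTransitive using (Star)
open import Relation.Nullary using (Dec; ¬_)

record Graph : Set₁ where
  field
    n      : ℕ
    Adj    : Fin n → Fin n → Set
    adjDec : ∀ x y → Dec (Adj x y)
    sym    : ∀ {x y} → Adj x y → Adj y x
    irrefl : ∀ {x} → ¬ Adj x x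

open Graph public

Vtx : Graph → Set
Vtx G = Fin (n G)

Connected : Graph → Set
Connected G = ∀ (x y : Vtx G) → Star (Adj G) x y

Nontrivial : Graph → Set
Nontrivial G = Σ (Vtx G) λ x → Σ (Vtx G) λ y → x ≢ y

BoxV : Graph → Graph → Set
BoxV G H = Vtx G × Vtx H

BoxAdj : (G H : Graph) → BoxV G H → BoxV G H → Set
BoxAdj G H (g₁ , h₁) (g₂ , h₂) = (Adj G g₁ g₂ × h₁ ≡ h₂) ⊎ (g₁ ≡ g₂ × Adj H h₁ h₂)

module CycleConvexity {V : Set} (E : V → V → Set) where

  Subset : Set₁
  Subset = V → Set

  _⊆_ : Subset → Subset → Set
  A ⊆ B = ∀ v → A v → B v

  -- w lies on a cycle of the induced subgraph on P, through w:
  -- distinct vertices w, v₁, …, vₖ (k ≥ 2) in P, consecutive ones adjacent,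
  -- and vₖ adjacent to w.
  OnCycleIn : Subset → V → Set
  OnCycleIn P w =
    Σ (List V) λ mid → Σ V λ u →
      let cyc = w ∷ (mid ∷ʳ u) in
      length mid ≥ 1 × Unique cyc × Linked E cyc × E u w × All P cyc

  Interval : Subset → Subset
  Interval S w = S w ⊎ OnCycleIn (λ v → S v ⊎ v ≡ w) w

  Convex : Subset → Set
  Convex S = Interval S ⊆ S

  Hull : Subset → V → Set₁
  Hull S v = ∀ (C : Subset) → S ⊆ C → Convex C → C v

  IsHullSet : Subset → Set₁
  IsHullSet S = ∀ v → Hull S v

{-# OPTIONS --safe #-}
module Submission where

-- A convex set C that contains three corners of a square (a,c), (a,d), (b,c), (b,d)
-- of G □ H contains the fourth, since the square is a 4-cycle through it. So if C
-- contains the row V(G) × {c} and one vertex of an adjacent row V(G) × {d}, it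
-- contains that whole row, by walking along paths of G. Starting from the row
-- V(G) × {h} and using the column {g} × V(H) for the first vertex of every new row,
-- paths of H sweep out all of G □ H.

open import Defs
open import Data.Product using (Σ; _×_; _,_)
open import Data.Product.Properties using (,-injectiveˡ; ,-injectiveʳ)
open import Data.Sum using (inj₁; inj₂)
open import Data.Nat using (s≤s; z≤n)
open import Data.List using ([]; _∷_)
open import Data.List.Relation.Unary.All using (All; []; _∷_)
open import Data.List.Relation.Unary.AllPairs using ([]; _∷_)
open import Data.List.Relation.Unary.Linked using (Linked; [-]; _∷_)
open import Data.List.Relation.Unary.Unique.Propositional using (Unique)
open import Relation.Binary.PropositionalEquality using (_≢_; refl; ≢-sym) renaming (sym to ≡-sym)
open import Relation.Binary.Construct.Closure.ReflexiveTransitive using (Star; ε; _◅_)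

module _ {V : Set} {E : V → V → Set} where
  open CycleConvexity E

  Convex⇒4-cycle-closed : ∀ {C w p q u} → Convex C →
                          Unique (w ∷ p ∷ q ∷ u ∷ []) → Linked E (w ∷ p ∷ q ∷ u ∷ []) → E u w →
                          All C (p ∷ q ∷ u ∷ []) → C w
  Convex⇒4-cycle-closed {p = p} {q} cv unique path closing (Cp ∷ Cq ∷ Cu ∷ []) =
    cv _ (inj₂ (p ∷ q ∷ [] , _ , s≤s z≤n , unique , path , closing ,
                inj₂ refl ∷ inj₁ Cp ∷ inj₁ Cq ∷ inj₁ Cu ∷ []))

Adj⇒≢ : (G : Graph) → ∀ {x y} → Adj G x y → x ≢ y
Adj⇒≢ G xy refl = irrefl G xy

module _ (G H : Graph) where
  open CycleConvexity (BoxAdj G H)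

  Row : Subset → Vtx H → Set
  Row C h = ∀ g → C (g , h)

  Column : Subset → Vtx G → Set
  Column C g = ∀ h → C (g , h)

  Convex⇒square-closed : ∀ {C a b c d} → Convex C → Adj G a b → Adj H c d →
                         C (a , c) → C (a , d) → C (b , c) → C (b , d)
  Convex⇒square-closed {a = a} {b} {c} {d} cv ab cd Cac Cad Cbc =
    Convex⇒4-cycle-closed cv unique
      (inj₁ (sym G ab , refl) ∷ inj₂ (refl , sym H cd) ∷ inj₁ (ab , refl) ∷ [-])
      (inj₂ (refl , cd))
      (Cad ∷ Cac ∷ Cbc ∷ [])
    where
    a≢b : ∀ {y y′} → (a , y) ≢ (b , y′)
    a≢b e = Adj⇒≢ G ab (,-injectiveˡ e)
    b≢a : ∀ {y y′} → (b , y) ≢ (a , y′)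
    b≢a = ≢-sym a≢b
    d≢c : ∀ {x x′} → (x , d) ≢ (x′ , c)
    d≢c e = Adj⇒≢ H cd (≡-sym (,-injectiveʳ e))
    unique : Unique ((b , d) ∷ (a , d) ∷ (a , c) ∷ (b , c) ∷ [])
    unique = (b≢a ∷ b≢a ∷ d≢c ∷ []) ∷ (d≢c ∷ a≢b ∷ []) ∷ (a≢b ∷ []) ∷ [] ∷ []

  Convex⇒row-spreads : ∀ {C c d a b} → Convex C → Adj H c d → Row C c →
                       C (a , d) → Star (Adj G) a b → C (b , d)
  Convex⇒row-spreads cv cd row Cad ε = Cad
  Convex⇒row-spreads cv cd row Cad (ab ◅ path) =
    Convex⇒row-spreads cv cd row (Convex⇒square-closed cv ab cd (row _) Cad (row _)) path

  Convex⇒rows-spread : ∀ {C g c d} → Convex C → Connected G → Column C g →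
                       Star (Adj H) c d → Row C c → Row C d
  Convex⇒rows-spread cv conn col ε row = row
  Convex⇒rows-spread {g = g} cv conn col (cd ◅ path) row =
    Convex⇒rows-spread cv conn col path (λ x → Convex⇒row-spreads cv cd row (col _) (conn g x))

  Convex⇒row∪column⇒full : ∀ {C g h} → Convex C → Connected G → Connected H →
                           Row C h → Column C g → ∀ v → C v
  Convex⇒row∪column⇒full {h = h} cv connG connH row col (x , y) =
    Convex⇒rows-spread cv connG col (connH h y) row x

mainTheorem14 : (G H : Graph) → Connected G → Connected H → Nontrivial G → Nontrivial H
    → (S : BoxV G H → Set)
    → Σ (Vtx G) (λ g → Σ (Vtx H) λ h →
         ((g′ : Vtx G) → CycleConvexity.Hull (BoxAdj G H) S (g′ , h))
         × ((h′ : Vtx H) → CycleConvexity.Hull (BoxAdj G H) S (g , h′)))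
    → CycleConvexity.IsHullSet (BoxAdj G H) S
mainTheorem14 G H connG connH _ _ S (g , h , rowInHull , columnInHull) v C S⊆C convex =
  Convex⇒row∪column⇒full G H convex connG connH
    (λ g′ → rowInHull g′ C S⊆C convex)
    (λ h′ → columnInHull h′ C S⊆C convex)
    v
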